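{- Let $t\geq 3$ and let $\Delta$ be a $t$-colorable simplicial complex. Then \[{\rm cl}_t(\Delta)\leq 2^t \biggl(\frac{{\rm cl}_{t-1}(\Delta)}{t}\biggr)^{t/(t-1)}.\]
   Context: A (finite abstract) simplicial complex $\Delta$ is $t$-colorable if there is a map from its vertex set to $[t]$ such that the vertices of every face receive pairwise distinct colors. For an integer $i$, ${\rm cl}_i(\Delta)$ denotes the number of $i$-faces of $\Delta$, i.e. faces consisting of exactly $i$ vertices. -}

module Defs where

open import Data.Nat using (ℕ; zero; suc; _*_; _^_; _≤_; _≡ᵇ_)
open import Data.Bool using (Bool; true; false; _∧_)
open import Data.Product using (Σ)
open import Data.Fin using (Fin)
open import Data.Fin.Subset using (Subset; _⊆_; _∈_; ∣_∣)
open import Data.Vec using (Vec; []; _∷_)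
open import Data.List using (List; []; _∷_; map; _++_; filter; length)
open import Relation.Binary.PropositionalEquality using (_≡_)

record SimplicialComplex (n : ℕ) : Set where
  field
    isFace   : Subset n → Bool
    downward : ∀ (σ τ : Subset n) → τ ⊆ σ → isFace σ ≡ true → isFace τ ≡ true

open SimplicialComplex public

allSubsets : (n : ℕ) → List (Subset n)
allSubsets zero    = [] ∷ []
allSubsets (suc n) = map (true ∷_) (allSubsets n) ++ map (false ∷_) (allSubsets n)

count : ∀ {A : Set} → (A → Bool) → List A → ℕ
count p []       = 0
count p (x ∷ xs) with p x
... | true  = suc (count p xs)
... | false = count p xs

cl : ∀ {n} → ℕ → SimplicialComplex n → ℕ
cl {n} i Δ = count (λ σ → isFace Δ σ ∧ (∣ σ ∣ ≡ᵇ i)) (allSubsets n)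

Colorable : ∀ {n} → ℕ → SimplicialComplex n → Set
Colorable {n} t Δ =
  Σ (Fin n → Fin t) λ c →
    ∀ (σ : Subset n) → isFace Δ σ ≡ true →
    ∀ (u v : Fin n) → u ∈ σ → v ∈ σ → c u ≡ c v → u ≡ v

{-# OPTIONS --safe #-}
module Submission where

-- Write f_j for cl j Δ. We prove the stronger f_t^(t-1) ≤ f_(t-1)^t for t-colorable Δ, t ≥ 2,
-- which implies the theorem because t ≤ 2^(t-1). Induct on t and fix a color class W.
-- Every t-face meets W (pigeonhole) and deleting its W-vertex v leaves a (t-1)-face of the
-- link of v, so f_t ≤ Σ_{v∈W} f_(t-1)(lk v). The link of v is (t-1)-colorable and its faces
-- miss W, so the induction hypothesis gives f_(t-1)(lk v) ≤ f_(t-2)(lk v) · B^(1/(t-1)), where B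
-- counts the (t-1)-faces of Δ missing W. Every (t-1)-face meets W at most once, whence
-- Σ_{v∈W} f_(t-2)(lk v) + B ≤ f_(t-1), and summing over v ∈ W gives
-- f_t ≤ Σ_{v∈W} f_(t-2)(lk v) · B^(1/(t-1)) ≤ f_(t-1) · f_(t-1)^(1/(t-1)).

open import Data.Bool using (Bool; true; false; _∧_; not; if_then_else_; T)
open import Data.Bool.Properties using (not-injective; ∧-identityʳ)
open import Data.Fin using (Fin; zero; suc; pinch)
open import Data.Fin.Properties using (_≟_; suc-injective; 0≢1+n; pinch-injective)
open import Data.Fin.Subset
  using (Subset; inside; outside; _∈_; _⊆_; _∩_; _∪_; ⁅_⁆; ⊥; ∣_∣)
open import Data.Fin.Subset.Properties
  using (⊥⊆; ∣⊥∣≡0; Empty-unique; x∈p∩q⁻; x∈p∪q⁺; x∈p∪q⁻; x∈⁅x⁆; p⊆p∪q; ∪-identityʳ)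
open import Data.List using ([]; _∷_; _++_; map)
open import Data.Nat using (ℕ; zero; suc; _+_; _*_; _^_; _∸_; _≤_; _<_; z≤n; s≤s; _≡ᵇ_)
open import Data.Nat.Properties
  using ( +-comm; +-identityʳ; *-comm; *-identityˡ; *-identityʳ; *-distribˡ-+; *-distribʳ-+
        ; ≡ᵇ⇒≡; ≤-refl; ≤-reflexive; ≤-trans; ≤-total; ≤-<-trans; n≤0⇒n≡0; m≤m+n; m≤n+m; m<m+n
        ; +-mono-≤; +-monoˡ-≤; +-monoʳ-≤; +-cancelʳ-≤; *-mono-≤; *-monoˡ-≤; *-monoʳ-≤; *-cancelʳ-≤
        ; ^-identityʳ; ^-*-assoc; ^-monoˡ-≤; m^n≢0; m^n>0; m^n≡0⇒m≡0
        ; module ≤-Reasoning; +-0-commutativeMonoid; +-*-semiring )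
open import Data.Nat.Tactic.RingSolver using (solve-∀)
open import Data.Product using (_×_; _,_; proj₁; proj₂)
open import Data.Sum using (inj₁; inj₂; [_,_]′)
open import Data.Unit using (tt)
open import Data.Vec using ([]; _∷_; here; there; lookup; tabulate)
open import Data.Vec.Functional using (removeAt)
open import Data.Vec.Properties using (lookup-zipWith; lookup∘tabulate; []=⇒lookup; lookup⇒[]=)
open import Function using (_∘_)
open import Relation.Binary.PropositionalEquality
  using (_≡_; _≢_; refl; sym; trans; cong; cong₂; subst; subst₂; module ≡-Reasoning)
open import Relation.Nullary using (does; yes; no; contradiction)
open import Algebra.Properties.CommutativeMonoid.Sum +-0-commutativeMonoid
  using (sum; sum-syntax; ∑-comm; ∑-distrib-+; sum-remove; sum-cong-≗; sum-replicate-zero)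
open import Algebra.Properties.Semiring.Sum +-*-semiring using (*-distribˡ-sum)
open import Defs

𝟙 : Bool → ℕ
𝟙 b = if b then 1 else 0

𝟙-∧ : ∀ a b → 𝟙 (a ∧ b) ≡ 𝟙 a * 𝟙 b
𝟙-∧ true  b = sym (*-identityˡ (𝟙 b))
𝟙-∧ false b = refl

∧-true⁻ : ∀ {a b} → a ∧ b ≡ true → a ≡ true × b ≡ true
∧-true⁻ {true} {true} refl = refl , refl

module _ {A : Set} (p : A → Bool) where

  count-++ : ∀ xs ys → count p (xs ++ ys) ≡ count p xs + count p ys
  count-++ []       ys = refl
  count-++ (x ∷ xs) ys with p x
  ... | true  = cong suc (count-++ xs ys)
  ... | false = count-++ xs ys

  count-map : ∀ {B : Set} (f : B → A) xs → count p (map f xs) ≡ count (p ∘ f) xs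
  count-map f []       = refl
  count-map f (x ∷ xs) with p (f x)
  ... | true  = cong suc (count-map f xs)
  ... | false = count-map f xs

∑ˢ : ∀ {n} → (Subset n → ℕ) → ℕ
∑ˢ {zero}  f = f []
∑ˢ {suc n} f = ∑ˢ (f ∘ (inside ∷_)) + ∑ˢ (f ∘ (outside ∷_))

count-allSubsets : ∀ n (p : Subset n → Bool) → count p (allSubsets n) ≡ ∑ˢ (𝟙 ∘ p)
count-allSubsets zero p with p []
... | true  = refl
... | false = refl
count-allSubsets (suc n) p = begin
  count p (map (inside ∷_) S ++ map (outside ∷_) S)
    ≡⟨ count-++ p (map (inside ∷_) S) (map (outside ∷_) S) ⟩
  count p (map (inside ∷_) S) + count p (map (outside ∷_) S)
    ≡⟨ cong₂ _+_ (count-map p _ S) (count-map p _ S) ⟩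
  count (p ∘ (inside ∷_)) S + count (p ∘ (outside ∷_)) S
    ≡⟨ cong₂ _+_ (count-allSubsets n (p ∘ (inside ∷_))) (count-allSubsets n (p ∘ (outside ∷_))) ⟩
  ∑ˢ (𝟙 ∘ p) ∎
  where
  open ≡-Reasoning
  S = allSubsets n

∑ˢ-cong : ∀ {n} {f g : Subset n → ℕ} → (∀ σ → f σ ≡ g σ) → ∑ˢ f ≡ ∑ˢ g
∑ˢ-cong {zero}  f≗g = f≗g []
∑ˢ-cong {suc n} f≗g = cong₂ _+_ (∑ˢ-cong (f≗g ∘ (inside ∷_))) (∑ˢ-cong (f≗g ∘ (outside ∷_)))

∑ˢ-mono-≤ : ∀ {n} {f g : Subset n → ℕ} → (∀ σ → f σ ≤ g σ) → ∑ˢ f ≤ ∑ˢ g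
∑ˢ-mono-≤ {zero}  f≤g = f≤g []
∑ˢ-mono-≤ {suc n} f≤g = +-mono-≤ (∑ˢ-mono-≤ (f≤g ∘ (inside ∷_))) (∑ˢ-mono-≤ (f≤g ∘ (outside ∷_)))

∑ˢ-distrib-+ : ∀ {n} (f g : Subset n → ℕ) → ∑ˢ (λ σ → f σ + g σ) ≡ ∑ˢ f + ∑ˢ g
∑ˢ-distrib-+ {zero}  f g = refl
∑ˢ-distrib-+ {suc n} f g = begin
  ∑ˢ (λ σ → f⁺ σ + g⁺ σ) + ∑ˢ (λ σ → f⁻ σ + g⁻ σ)
    ≡⟨ cong₂ _+_ (∑ˢ-distrib-+ f⁺ g⁺) (∑ˢ-distrib-+ f⁻ g⁻) ⟩
  (∑ˢ f⁺ + ∑ˢ g⁺) + (∑ˢ f⁻ + ∑ˢ g⁻)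
    ≡⟨ interchange (∑ˢ f⁺) (∑ˢ g⁺) (∑ˢ f⁻) (∑ˢ g⁻) ⟩
  (∑ˢ f⁺ + ∑ˢ f⁻) + (∑ˢ g⁺ + ∑ˢ g⁻) ∎
  where
  open ≡-Reasoning
  f⁺ f⁻ g⁺ g⁻ : Subset n → ℕ
  f⁺ = f ∘ (inside ∷_)
  f⁻ = f ∘ (outside ∷_)
  g⁺ = g ∘ (inside ∷_)
  g⁻ = g ∘ (outside ∷_)
  interchange : ∀ a b c d → (a + b) + (c + d) ≡ (a + c) + (b + d)
  interchange = solve-∀

*-distribˡ-∑ˢ : ∀ {n} x (f : Subset n → ℕ) → x * ∑ˢ f ≡ ∑ˢ (λ σ → x * f σ)
*-distribˡ-∑ˢ {zero}  x f = refl
*-distribˡ-∑ˢ {suc n} x f =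
  trans (*-distribˡ-+ x _ _)
        (cong₂ _+_ (*-distribˡ-∑ˢ x (f ∘ (inside ∷_))) (*-distribˡ-∑ˢ x (f ∘ (outside ∷_))))

∑ˢ-comm : ∀ {n m} (h : Subset n → Fin m → ℕ) →
  ∑ˢ (λ σ → ∑[ v < m ] h σ v) ≡ ∑[ v < m ] ∑ˢ (λ σ → h σ v)
∑ˢ-comm {zero}  h = refl
∑ˢ-comm {suc n} h =
  trans (cong₂ _+_ (∑ˢ-comm (h ∘ (inside ∷_))) (∑ˢ-comm (h ∘ (outside ∷_))))
        (sym (∑-distrib-+ (λ v → ∑ˢ (λ σ → h (inside ∷ σ) v)) (λ v → ∑ˢ (λ σ → h (outside ∷ σ) v))))

∑ˢ-∋ : ∀ {n} (v : Fin n) (f : Subset n → ℕ) →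
  ∑ˢ (λ σ → 𝟙 (lookup σ v) * f σ) ≡ ∑ˢ (λ τ → 𝟙 (not (lookup τ v)) * f (τ ∪ ⁅ v ⁆))
∑ˢ-∋ {suc n} zero f =
  trans (+-comm (∑ˢ (λ σ → 1 * f (inside ∷ σ))) (∑ˢ {n} (λ _ → 0)))
        (cong (∑ˢ {n} (λ _ → 0) +_)
              (∑ˢ-cong λ τ → cong (λ τ′ → 1 * f (inside ∷ τ′)) (sym (∪-identityʳ τ))))
∑ˢ-∋ {suc n} (suc v) f = cong₂ _+_ (∑ˢ-∋ v (f ∘ (inside ∷_))) (∑ˢ-∋ v (f ∘ (outside ∷_)))

term≤∑ˢ : ∀ {n} (f : Subset n → ℕ) σ → f σ ≤ ∑ˢ f
term≤∑ˢ f []            = ≤-refl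
term≤∑ˢ f (inside ∷ σ)  = ≤-trans (term≤∑ˢ (f ∘ (inside ∷_)) σ) (m≤m+n _ _)
term≤∑ˢ f (outside ∷ σ) = ≤-trans (term≤∑ˢ (f ∘ (outside ∷_)) σ) (m≤n+m _ _)

∑≤n : ∀ {n} {f : Fin n → ℕ} → (∀ i → f i ≤ 1) → ∑[ i < n ] f i ≤ n
∑≤n {zero}  _   = z≤n
∑≤n {suc n} f≤1 = +-mono-≤ (f≤1 zero) (∑≤n (f≤1 ∘ suc))

∣p∣≡∑ : ∀ {n} (p : Subset n) → ∣ p ∣ ≡ ∑[ v < n ] 𝟙 (lookup p v)
∣p∣≡∑ []            = refl
∣p∣≡∑ (inside ∷ p)  = cong suc (∣p∣≡∑ p)
∣p∣≡∑ (outside ∷ p) = ∣p∣≡∑ p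

∣p∩q∣≡∑ : ∀ {n} (p q : Subset n) → ∣ p ∩ q ∣ ≡ ∑[ v < n ] (𝟙 (lookup p v) * 𝟙 (lookup q v))
∣p∩q∣≡∑ p q = trans (∣p∣≡∑ (p ∩ q)) (sum-cong-≗ λ v →
  trans (cong 𝟙 (lookup-zipWith _∧_ v p q)) (𝟙-∧ (lookup p v) (lookup q v)))

∣p∪⁅x⁆∣≡1+∣p∣ : ∀ {n} (p : Subset n) x → lookup p x ≡ outside → ∣ p ∪ ⁅ x ⁆ ∣ ≡ suc ∣ p ∣
∣p∪⁅x⁆∣≡1+∣p∣ (outside ∷ p) zero    _   = cong (suc ∘ ∣_∣) (∪-identityʳ p)
∣p∪⁅x⁆∣≡1+∣p∣ (inside ∷ p)  (suc x) x∉p = cong suc (∣p∪⁅x⁆∣≡1+∣p∣ p x x∉p)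
∣p∪⁅x⁆∣≡1+∣p∣ (outside ∷ p) (suc x) x∉p = ∣p∪⁅x⁆∣≡1+∣p∣ p x x∉p

∣p∣≤1 : ∀ {n} (p : Subset n) → (∀ {u w} → u ∈ p → w ∈ p → u ≡ w) → ∣ p ∣ ≤ 1
∣p∣≤1 []            _      = z≤n
∣p∣≤1 (outside ∷ p) unique = ∣p∣≤1 p λ u∈p w∈p → suc-injective (unique (there u∈p) (there w∈p))
∣p∣≤1 {suc n} (inside ∷ p) unique = s≤s (≤-reflexive (begin
  ∣ p ∣     ≡⟨ cong ∣_∣ (Empty-unique λ (w , w∈p) → 0≢1+n (unique here (there w∈p))) ⟩
  ∣ ⊥ {n} ∣ ≡⟨ ∣⊥∣≡0 n ⟩
  0         ∎))
  where open ≡-Reasoning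

InjectiveOn : ∀ {n} {A : Set} → (Fin n → A) → Subset n → Set
InjectiveOn c p = ∀ u v → u ∈ p → v ∈ p → c u ≡ c v → u ≡ v

colorClass : ∀ {n t} → (Fin n → Fin t) → Fin t → Subset n
colorClass c j = tabulate (λ v → does (c v ≟ j))

∈-colorClass⁻ : ∀ {n t} {c : Fin n → Fin t} {j v} → v ∈ colorClass c j → c v ≡ j
∈-colorClass⁻ {c = c} {j} {v} v∈C with c v ≟ j | trans (sym (lookup∘tabulate _ v)) ([]=⇒lookup v∈C)
... | yes cv≡j | _ = cv≡j
... | no  _    | ()

∑-𝟙-≟ : ∀ {t} (i : Fin t) → ∑[ j < t ] 𝟙 (does (i ≟ j)) ≡ 1
∑-𝟙-≟ {suc t} zero    = cong suc (sum-replicate-zero t)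
∑-𝟙-≟         (suc i) = ∑-𝟙-≟ i

∣p∣≡∑∣p∩colorClass∣ : ∀ {n t} (c : Fin n → Fin t) p → ∣ p ∣ ≡ ∑[ j < t ] ∣ p ∩ colorClass c j ∣
∣p∣≡∑∣p∩colorClass∣ {n} {t} c p = begin
  ∣ p ∣                                ≡⟨ ∣p∣≡∑ p ⟩
  ∑[ v < n ] 𝟙 (lookup p v)            ≡⟨ sum-cong-≗ split ⟩
  ∑[ v < n ] ∑[ j < t ] h v j          ≡⟨ ∑-comm h ⟩
  ∑[ j < t ] ∑[ v < n ] h v j          ≡⟨ sum-cong-≗ (λ j → ∣p∩q∣≡∑ p (colorClass c j)) ⟨
  ∑[ j < t ] ∣ p ∩ colorClass c j ∣    ∎
  where
  open ≡-Reasoning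
  h : Fin n → Fin t → ℕ
  h v j = 𝟙 (lookup p v) * 𝟙 (lookup (colorClass c j) v)
  split : ∀ v → 𝟙 (lookup p v) ≡ ∑[ j < t ] h v j
  split v = begin
    𝟙 (lookup p v)                                   ≡⟨ *-identityʳ _ ⟨
    𝟙 (lookup p v) * 1                               ≡⟨ cong (𝟙 (lookup p v) *_) (∑-𝟙-≟ (c v)) ⟨
    𝟙 (lookup p v) * ∑[ j < t ] 𝟙 (does (c v ≟ j))   ≡⟨ *-distribˡ-sum (𝟙 (lookup p v)) (𝟙 ∘ does ∘ (c v ≟_)) ⟩
    ∑[ j < t ] (𝟙 (lookup p v) * 𝟙 (does (c v ≟ j))) ≡⟨ sum-cong-≗ (λ j → cong (λ b → 𝟙 (lookup p v) * 𝟙 b)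
                                                          (lookup∘tabulate (λ w → does (c w ≟ j)) v)) ⟨
    ∑[ j < t ] h v j                                 ∎

∣p∩colorClass∣≤1 : ∀ {n t} {c : Fin n → Fin t} {p} → InjectiveOn c p → ∀ j → ∣ p ∩ colorClass c j ∣ ≤ 1
∣p∩colorClass∣≤1 {c = c} {p} injective j = ∣p∣≤1 (p ∩ colorClass c j) λ u∈ w∈ →
  let u∈p , u∈C = x∈p∩q⁻ p _ u∈
      w∈p , w∈C = x∈p∩q⁻ p _ w∈
  in injective _ _ u∈p w∈p (trans (∈-colorClass⁻ {c = c} u∈C) (sym (∈-colorClass⁻ {c = c} w∈C)))

∣p∣≤∣p∩colorClass∣+t : ∀ {n t} (c : Fin n → Fin (suc t)) {p} → InjectiveOn c p →
  ∀ x → ∣ p ∣ ≤ ∣ p ∩ colorClass c x ∣ + t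
∣p∣≤∣p∩colorClass∣+t {t = t} c {p} injective x = begin
  ∣ p ∣                            ≡⟨ ∣p∣≡∑∣p∩colorClass∣ c p ⟩
  ∑[ j < suc t ] size j            ≡⟨ sum-remove {i = x} size ⟩
  size x + sum (removeAt size x)   ≤⟨ +-monoʳ-≤ (size x) (∑≤n (λ _ → ∣p∩colorClass∣≤1 injective _)) ⟩
  size x + t                       ∎
  where
  open ≤-Reasoning
  size : Fin (suc t) → ℕ
  size j = ∣ p ∩ colorClass c j ∣

isFaceOfSize : ∀ {n} → ℕ → SimplicialComplex n → Subset n → Bool
isFaceOfSize j Δ σ = isFace Δ σ ∧ (∣ σ ∣ ≡ᵇ j)

isFaceOfSize⁻ : ∀ {n j} (Δ : SimplicialComplex n) σ →
  isFaceOfSize j Δ σ ≡ true → isFace Δ σ ≡ true × ∣ σ ∣ ≡ j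
isFaceOfSize⁻ {j = j} Δ σ σ∈Δⱼ with ∧-true⁻ σ∈Δⱼ
... | σ∈Δ , ∣σ∣≡ᵇj = σ∈Δ , ≡ᵇ⇒≡ ∣ σ ∣ j (subst T (sym ∣σ∣≡ᵇj) tt)

cl≡∑ˢ : ∀ {n} j (Δ : SimplicialComplex n) → cl j Δ ≡ ∑ˢ (𝟙 ∘ isFaceOfSize j Δ)
cl≡∑ˢ {n} j Δ = count-allSubsets n (isFaceOfSize j Δ)

IsColoring : ∀ {n t} → SimplicialComplex n → (Fin n → Fin t) → Set
IsColoring Δ c = ∀ σ → isFace Δ σ ≡ true → InjectiveOn c σ

link : ∀ {n} → SimplicialComplex n → Fin n → SimplicialComplex n
link {n} Δ v = record
  { isFace   = λ τ → not (lookup τ v) ∧ isFace Δ (τ ∪ ⁅ v ⁆)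
  ; downward = downward-link
  }
  where
  ∪⁅v⁆-mono : ∀ {σ τ : Subset n} → τ ⊆ σ → τ ∪ ⁅ v ⁆ ⊆ σ ∪ ⁅ v ⁆
  ∪⁅v⁆-mono {τ = τ} τ⊆σ x∈ = [ x∈p∪q⁺ ∘ inj₁ ∘ τ⊆σ , x∈p∪q⁺ ∘ inj₂ ]′ (x∈p∪q⁻ τ ⁅ v ⁆ x∈)

  downward-link : ∀ σ τ → τ ⊆ σ →
    not (lookup σ v) ∧ isFace Δ (σ ∪ ⁅ v ⁆) ≡ true → not (lookup τ v) ∧ isFace Δ (τ ∪ ⁅ v ⁆) ≡ true
  downward-link σ τ τ⊆σ σ∈lk with ∧-true⁻ σ∈lk | lookup τ v in v∈?τ
  ... | _   , σ∪v∈Δ | outside = downward Δ _ _ (∪⁅v⁆-mono τ⊆σ) σ∪v∈Δ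
  ... | v∉σ , _     | inside  = contradiction
    (trans (sym ([]=⇒lookup (τ⊆σ (lookup⇒[]= v τ v∈?τ)))) (not-injective v∉σ)) λ ()

cl-link : ∀ {n} j (Δ : SimplicialComplex n) v →
  cl j (link Δ v) ≡ ∑ˢ (λ σ → 𝟙 (lookup σ v) * 𝟙 (isFaceOfSize (suc j) Δ σ))
cl-link j Δ v = begin
  cl j (link Δ v)                                 ≡⟨ cl≡∑ˢ j (link Δ v) ⟩
  ∑ˢ (𝟙 ∘ isFaceOfSize j (link Δ v))              ≡⟨ ∑ˢ-cong link-face ⟩
  ∑ˢ (λ τ → 𝟙 (not (lookup τ v)) * F (τ ∪ ⁅ v ⁆)) ≡⟨ ∑ˢ-∋ v F ⟨
  ∑ˢ (λ σ → 𝟙 (lookup σ v) * F σ)                 ∎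
  where
  open ≡-Reasoning
  F = 𝟙 ∘ isFaceOfSize (suc j) Δ
  link-face : ∀ τ → 𝟙 (isFaceOfSize j (link Δ v) τ) ≡ 𝟙 (not (lookup τ v)) * F (τ ∪ ⁅ v ⁆)
  link-face τ with lookup τ v in v∉τ
  ... | inside  = refl
  ... | outside rewrite ∣p∪⁅x⁆∣≡1+∣p∣ τ v v∉τ = sym (*-identityˡ _)

∑-cl-link : ∀ {n} j (Δ : SimplicialComplex n) (W : Subset n) →
  ∑[ v < n ] (𝟙 (lookup W v) * cl j (link Δ v)) ≡ ∑ˢ (λ σ → 𝟙 (isFaceOfSize (suc j) Δ σ) * ∣ σ ∩ W ∣)
∑-cl-link {n} j Δ W = begin
  ∑[ v < n ] (W∋ v * cl j (link Δ v))
    ≡⟨ sum-cong-≗ (λ v → cong (W∋ v *_) (cl-link j Δ v)) ⟩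
  ∑[ v < n ] (W∋ v * ∑ˢ (λ σ → 𝟙 (lookup σ v) * F σ))
    ≡⟨ sum-cong-≗ (λ v → *-distribˡ-∑ˢ (W∋ v) (λ σ → 𝟙 (lookup σ v) * F σ)) ⟩
  ∑[ v < n ] ∑ˢ (λ σ → W∋ v * (𝟙 (lookup σ v) * F σ))
    ≡⟨ ∑ˢ-comm (λ σ v → W∋ v * (𝟙 (lookup σ v) * F σ)) ⟨
  ∑ˢ (λ σ → ∑[ v < n ] (W∋ v * (𝟙 (lookup σ v) * F σ)))
    ≡⟨ ∑ˢ-cong (λ σ → sum-cong-≗ (λ v → reorder (W∋ v) (𝟙 (lookup σ v)) (F σ))) ⟩
  ∑ˢ (λ σ → ∑[ v < n ] (F σ * (𝟙 (lookup σ v) * W∋ v)))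
    ≡⟨ ∑ˢ-cong (λ σ → *-distribˡ-sum (F σ) (λ v → 𝟙 (lookup σ v) * W∋ v)) ⟨
  ∑ˢ (λ σ → F σ * ∑[ v < n ] (𝟙 (lookup σ v) * W∋ v))
    ≡⟨ ∑ˢ-cong (λ σ → cong (F σ *_) (∣p∩q∣≡∑ σ W)) ⟨
  ∑ˢ (λ σ → F σ * ∣ σ ∩ W ∣) ∎
  where
  open ≡-Reasoning
  F = 𝟙 ∘ isFaceOfSize (suc j) Δ
  W∋ : Fin n → ℕ
  W∋ v = 𝟙 (lookup W v)
  reorder : ∀ w s f → w * (s * f) ≡ f * (s * w)
  reorder = solve-∀

link-avoids-color : ∀ {n t} {Δ : SimplicialComplex n} {c : Fin n → Fin t} → IsColoring Δ c →
  ∀ {v τ u} → isFace (link Δ v) τ ≡ true → u ∈ τ → c u ≢ c v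
link-avoids-color proper {v} {τ} {u} τ∈lk u∈τ cu≡cv with ∧-true⁻ τ∈lk
... | v∉τ , τ∪v∈Δ
  with refl ← proper _ τ∪v∈Δ u v (x∈p∪q⁺ (inj₁ u∈τ)) (x∈p∪q⁺ (inj₂ (x∈⁅x⁆ v))) cu≡cv
  = contradiction (trans (sym (cong not ([]=⇒lookup u∈τ))) v∉τ) λ ()

link-colorable : ∀ {n t} {Δ : SimplicialComplex n} {c : Fin n → Fin (suc t)} → IsColoring Δ c →
  ∀ (i : Fin t) {v} → c v ≡ suc i → Colorable t (link Δ v)
link-colorable {Δ = Δ} {c} proper i {v} cv≡ = pinch i ∘ c , injective
  where
  injective : IsColoring (link Δ v) (pinch i ∘ c)
  injective τ τ∈lk u w u∈τ w∈τ =
    proper (τ ∪ ⁅ v ⁆) (proj₂ (∧-true⁻ τ∈lk)) u w (x∈p∪q⁺ (inj₁ u∈τ)) (x∈p∪q⁺ (inj₁ w∈τ))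
    ∘ pinch-injective (avoids u∈τ) (avoids w∈τ)
    where
    avoids : ∀ {x} → x ∈ τ → suc i ≢ c x
    avoids x∈τ i≡cx = link-avoids-color {Δ = Δ} {c} proper {v} τ∈lk x∈τ (trans (sym i≡cx) (sym cv≡))

^-distribʳ-* : ∀ m n o → (m * n) ^ o ≡ m ^ o * n ^ o
^-distribʳ-* m n zero    = refl
^-distribʳ-* m n (suc o) =
  trans (cong (m * n *_) (^-distribʳ-* m n o)) (interchange m n (m ^ o) (n ^ o))
  where
  interchange : ∀ a b c d → a * b * (c * d) ≡ a * c * (b * d)
  interchange = solve-∀

-- x ^ suc k ≤ a ^ suc k * B encodes x ≤ a · B^(1/(k+1)) without roots.
module _ (k B : ℕ) where

  private
    m = suc k

  -- If x/a ≤ y/b then the mediant (x+y)/(a+b) is at most y/b.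
  mediant-root-bound : ∀ {x y a b} → x * b ≤ y * a →
    x ^ m ≤ a ^ m * B → y ^ m ≤ b ^ m * B → (x + y) ^ m ≤ (a + b) ^ m * B
  mediant-root-bound {x} {y} {a} {zero} _ x≤ y≤ with refl ← m^n≡0⇒m≡0 y m (n≤0⇒n≡0 y≤)
    rewrite +-identityʳ x | +-identityʳ a = x≤
  mediant-root-bound {x} {y} {a} {b@(suc _)} xb≤ya _ y≤ =
    *-cancelʳ-≤ _ _ (b ^ m) {{m^n≢0 b m}} (begin
      (x + y) ^ m * b ^ m       ≡⟨ ^-distribʳ-* (x + y) b m ⟨
      ((x + y) * b) ^ m         ≤⟨ ^-monoˡ-≤ m cross ⟩
      (y * (a + b)) ^ m         ≡⟨ ^-distribʳ-* y (a + b) m ⟩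
      y ^ m * (a + b) ^ m       ≤⟨ *-monoˡ-≤ ((a + b) ^ m) y≤ ⟩
      b ^ m * B * (a + b) ^ m   ≡⟨ reorder (b ^ m) B ((a + b) ^ m) ⟩
      (a + b) ^ m * B * b ^ m   ∎)
    where
    open ≤-Reasoning
    cross : (x + y) * b ≤ y * (a + b)
    cross = begin
      (x + y) * b   ≡⟨ *-distribʳ-+ b x y ⟩
      x * b + y * b ≤⟨ +-monoˡ-≤ (y * b) xb≤ya ⟩
      y * a + y * b ≡⟨ *-distribˡ-+ y a b ⟨
      y * (a + b)   ∎
    reorder : ∀ p q r → p * q * r ≡ r * q * p
    reorder = solve-∀

  root-bound-+ : ∀ {x y a b} →
    x ^ m ≤ a ^ m * B → y ^ m ≤ b ^ m * B → (x + y) ^ m ≤ (a + b) ^ m * B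
  root-bound-+ {x} {y} {a} {b} x≤ y≤ with ≤-total (x * b) (y * a)
  ... | inj₁ xb≤ya = mediant-root-bound {x} {y} {a} {b} xb≤ya x≤ y≤
  ... | inj₂ ya≤xb = subst₂ (λ s r → s ^ m ≤ r ^ m * B) (+-comm y x) (+-comm b a)
                            (mediant-root-bound {y} {x} {b} {a} ya≤xb y≤ x≤)

  root-bound-∑ : ∀ {n} {f g : Fin n → ℕ} → (∀ i → f i ^ m ≤ g i ^ m * B) →
    (∑[ i < n ] f i) ^ m ≤ (∑[ i < n ] g i) ^ m * B
  root-bound-∑ {zero}          _   = z≤n
  root-bound-∑ {suc n} {f} {g} f≤g =
    root-bound-+ {f zero} {∑[ i < n ] f (suc i)} {g zero} {∑[ i < n ] g (suc i)}
                 (f≤g zero) (root-bound-∑ (f≤g ∘ suc))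

n<2^n : ∀ n → n < 2 ^ n
n<2^n zero    = s≤s z≤n
n<2^n (suc n) = ≤-<-trans (n<2^n n) (m<m+n (2 ^ n) (≤-trans (m^n>0 2 n) (m≤m+n (2 ^ n) 0)))

n^n≤2^[n*[n∸1]] : ∀ n → n ^ n ≤ 2 ^ (n * (n ∸ 1))
n^n≤2^[n*[n∸1]] zero    = ≤-refl
n^n≤2^[n*[n∸1]] (suc n) = begin
  suc n ^ suc n   ≤⟨ ^-monoˡ-≤ (suc n) (n<2^n n) ⟩
  (2 ^ n) ^ suc n ≡⟨ ^-*-assoc 2 n (suc n) ⟩
  2 ^ (n * suc n) ≡⟨ cong (2 ^_) (*-comm n (suc n)) ⟩
  2 ^ (suc n * n) ∎
  where open ≤-Reasoning

module ColorClassCounting (k : ℕ) {n} (Δ : SimplicialComplex n) (c : Fin n → Fin (suc (suc k)))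
  (proper : IsColoring Δ c) where

  -- Color 1 because `pinch zero`, which merges colors 0 and 1, recolors links of W-vertices.
  W : Subset n
  W = colorClass c (suc zero)

  isFaceMissingW : Subset n → Bool
  isFaceMissingW σ = isFaceOfSize (suc k) Δ σ ∧ (∣ σ ∩ W ∣ ≡ᵇ 0)

  facesMissingW : ℕ
  facesMissingW = ∑ˢ (𝟙 ∘ isFaceMissingW)

  cl≤∑-cl-link : cl (suc (suc k)) Δ ≤ ∑[ v < n ] (𝟙 (lookup W v) * cl (suc k) (link Δ v))
  cl≤∑-cl-link = begin
    cl (suc (suc k)) Δ                                   ≡⟨ cl≡∑ˢ (suc (suc k)) Δ ⟩
    ∑ˢ F                                                 ≤⟨ ∑ˢ-mono-≤ meets-W ⟩
    ∑ˢ (λ σ → F σ * ∣ σ ∩ W ∣)                           ≡⟨ ∑-cl-link (suc k) Δ W ⟨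
    ∑[ v < n ] (𝟙 (lookup W v) * cl (suc k) (link Δ v))  ∎
    where
    open ≤-Reasoning
    F = 𝟙 ∘ isFaceOfSize (suc (suc k)) Δ
    meets-W : ∀ σ → F σ ≤ F σ * ∣ σ ∩ W ∣
    meets-W σ with isFaceOfSize (suc (suc k)) Δ σ in σ∈Δ
    ... | false = z≤n
    ... | true with σ∈Δ′ , ∣σ∣≡ ← isFaceOfSize⁻ Δ σ σ∈Δ = begin
      1              ≤⟨ +-cancelʳ-≤ (suc k) 1 ∣ σ ∩ W ∣ (subst (_≤ ∣ σ ∩ W ∣ + suc k) ∣σ∣≡
                          (∣p∣≤∣p∩colorClass∣+t c (proper σ σ∈Δ′) (suc zero))) ⟩
      ∣ σ ∩ W ∣      ≡⟨ *-identityˡ _ ⟨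
      1 * ∣ σ ∩ W ∣  ∎

  ∑-cl-link+facesMissingW≤cl :
    ∑[ v < n ] (𝟙 (lookup W v) * cl k (link Δ v)) + facesMissingW ≤ cl (suc k) Δ
  ∑-cl-link+facesMissingW≤cl = begin
    ∑[ v < n ] (𝟙 (lookup W v) * cl k (link Δ v)) + facesMissingW
      ≡⟨ cong (_+ facesMissingW) (∑-cl-link k Δ W) ⟩
    ∑ˢ (λ σ → F σ * ∣ σ ∩ W ∣) + facesMissingW
      ≡⟨ ∑ˢ-distrib-+ (λ σ → F σ * ∣ σ ∩ W ∣) (𝟙 ∘ isFaceMissingW) ⟨
    ∑ˢ (λ σ → F σ * ∣ σ ∩ W ∣ + 𝟙 (isFaceMissingW σ))
      ≤⟨ ∑ˢ-mono-≤ at-most-once ⟩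
    ∑ˢ F
      ≡⟨ cl≡∑ˢ (suc k) Δ ⟨
    cl (suc k) Δ ∎
    where
    open ≤-Reasoning
    F = 𝟙 ∘ isFaceOfSize (suc k) Δ
    hit-or-miss : ∀ h → h ≤ 1 → 1 * h + 𝟙 (h ≡ᵇ 0) ≤ 1
    hit-or-miss zero          _ = ≤-refl
    hit-or-miss (suc zero)    _ = ≤-refl
    hit-or-miss (suc (suc _)) (s≤s ())
    at-most-once : ∀ σ → F σ * ∣ σ ∩ W ∣ + 𝟙 (isFaceMissingW σ) ≤ F σ
    at-most-once σ with isFaceOfSize (suc k) Δ σ in σ∈Δ
    ... | false = z≤n
    ... | true  = hit-or-miss ∣ σ ∩ W ∣
                    (∣p∩colorClass∣≤1 (proper σ (proj₁ (isFaceOfSize⁻ Δ σ σ∈Δ))) (suc zero))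

  cl-link≤facesMissingW : ∀ {v} → lookup W v ≡ true → cl (suc k) (link Δ v) ≤ facesMissingW
  cl-link≤facesMissingW {v} v∈W = begin
    cl (suc k) (link Δ v)                    ≡⟨ cl≡∑ˢ (suc k) (link Δ v) ⟩
    ∑ˢ (𝟙 ∘ isFaceOfSize (suc k) (link Δ v)) ≤⟨ ∑ˢ-mono-≤ misses-W ⟩
    facesMissingW                            ∎
    where
    open ≤-Reasoning
    ∣τ∩W∣≡0 : ∀ {τ} → isFace (link Δ v) τ ≡ true → ∣ τ ∩ W ∣ ≡ 0
    ∣τ∩W∣≡0 {τ} τ∈lk = trans (cong ∣_∣ (Empty-unique λ (u , u∈τ∩W) →
      let u∈τ , u∈W = x∈p∩q⁻ τ W u∈τ∩W
      in link-avoids-color {Δ = Δ} {c} proper {v} τ∈lk u∈τ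
           (trans (∈-colorClass⁻ {c = c} u∈W) (sym (∈-colorClass⁻ {c = c} (lookup⇒[]= v W v∈W))))))
      (∣⊥∣≡0 n)
    misses-W : ∀ τ → 𝟙 (isFaceOfSize (suc k) (link Δ v) τ) ≤ 𝟙 (isFaceMissingW τ)
    misses-W τ with isFaceOfSize (suc k) (link Δ v) τ in τ∈lkₖ
    ... | false = z≤n
    ... | true with τ∈lk , ∣τ∣≡ᵇ ← ∧-true⁻ {isFace (link Δ v) τ} τ∈lkₖ
      rewrite downward Δ (τ ∪ ⁅ v ⁆) τ (p⊆p∪q ⁅ v ⁆) (proj₂ (∧-true⁻ τ∈lk)) | ∣τ∣≡ᵇ | ∣τ∩W∣≡0 τ∈lk
      = ≤-refl

-- f_t^(t-1) ≤ f_(t-1)^t multiplied by f_t, for t = k + 1; unlike that bound it also holds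
-- for t = 1, where the void complex has f_0 = 0.
WeakColorableBound : ℕ → Set
WeakColorableBound k = ∀ {n} (Δ : SimplicialComplex n) → Colorable (suc k) Δ →
  cl (suc k) Δ ^ suc k ≤ cl k Δ ^ suc k * cl (suc k) Δ

colorable-step : ∀ k → WeakColorableBound k → ∀ {n} (Δ : SimplicialComplex n) →
  Colorable (suc (suc k)) Δ → cl (suc (suc k)) Δ ^ suc k ≤ cl (suc k) Δ ^ suc (suc k)
colorable-step k ih {n} Δ (c , proper) = begin
  cl (suc m) Δ ^ m                                             ≤⟨ ^-monoˡ-≤ m cl≤∑-cl-link ⟩
  (∑[ v < n ] (𝟙 (lookup W v) * cl m (link Δ v))) ^ m         ≤⟨ root-bound-∑ k _ per-vertex ⟩
  (∑[ v < n ] (𝟙 (lookup W v) * cl k (link Δ v))) ^ m * facesMissingW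
                                                               ≤⟨ *-mono-≤ (^-monoˡ-≤ m links≤) missing≤ ⟩
  cl m Δ ^ m * cl m Δ                                          ≡⟨ *-comm (cl m Δ ^ m) (cl m Δ) ⟩
  cl m Δ ^ suc m                                               ∎
  where
  open ColorClassCounting k Δ c proper
  open ≤-Reasoning
  m = suc k
  links≤ : ∑[ v < n ] (𝟙 (lookup W v) * cl k (link Δ v)) ≤ cl m Δ
  links≤ = ≤-trans (m≤m+n _ facesMissingW) ∑-cl-link+facesMissingW≤cl
  missing≤ : facesMissingW ≤ cl m Δ
  missing≤ = ≤-trans (m≤n+m facesMissingW _) ∑-cl-link+facesMissingW≤cl
  per-vertex : ∀ v →
    (𝟙 (lookup W v) * cl m (link Δ v)) ^ m ≤ (𝟙 (lookup W v) * cl k (link Δ v)) ^ m * facesMissingW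
  per-vertex v with lookup W v in v∈W
  ... | false = z≤n
  ... | true rewrite *-identityˡ (cl m (link Δ v)) | *-identityˡ (cl k (link Δ v)) = begin
    cl m (link Δ v) ^ m                    ≤⟨ ih (link Δ v) (link-colorable {Δ = Δ} proper zero
                                                (∈-colorClass⁻ {c = c} (lookup⇒[]= v W v∈W))) ⟩
    cl k (link Δ v) ^ m * cl m (link Δ v)  ≤⟨ *-monoʳ-≤ (cl k (link Δ v) ^ m) (cl-link≤facesMissingW v∈W) ⟩
    cl k (link Δ v) ^ m * facesMissingW    ∎

cl≤cl₀*cl : ∀ {n} j (Δ : SimplicialComplex n) → cl j Δ ≤ cl 0 Δ * cl j Δ
cl≤cl₀*cl {n} j Δ = begin
  cl j Δ                                   ≡⟨ cl≡∑ˢ j Δ ⟩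
  ∑ˢ F                                     ≤⟨ ∑ˢ-mono-≤ needs-∅ ⟩
  ∑ˢ (λ σ → 𝟙 (isFace Δ ⊥) * F σ)          ≡⟨ *-distribˡ-∑ˢ (𝟙 (isFace Δ ⊥)) F ⟨
  𝟙 (isFace Δ ⊥) * ∑ˢ F                    ≡⟨ cong (𝟙 (isFace Δ ⊥) *_) (cl≡∑ˢ j Δ) ⟨
  𝟙 (isFace Δ ⊥) * cl j Δ                  ≤⟨ *-monoˡ-≤ (cl j Δ) ∅-counted ⟩
  cl 0 Δ * cl j Δ                          ∎
  where
  open ≤-Reasoning
  F = 𝟙 ∘ isFaceOfSize j Δ
  needs-∅ : ∀ σ → F σ ≤ 𝟙 (isFace Δ ⊥) * F σ
  needs-∅ σ with isFace Δ σ in σ∈Δ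
  ... | false = z≤n
  ... | true rewrite downward Δ σ ⊥ ⊥⊆ σ∈Δ = ≤-reflexive (sym (*-identityˡ _))
  ∅-counted : 𝟙 (isFace Δ ⊥) ≤ cl 0 Δ
  ∅-counted = begin
    𝟙 (isFace Δ ⊥)                ≡⟨ cong 𝟙 (∧-identityʳ (isFace Δ ⊥)) ⟨
    𝟙 (isFace Δ ⊥ ∧ (0 ≡ᵇ 0))     ≡⟨ cong (λ s → 𝟙 (isFace Δ ⊥ ∧ (s ≡ᵇ 0))) (∣⊥∣≡0 n) ⟨
    𝟙 (isFaceOfSize 0 Δ ⊥)        ≤⟨ term≤∑ˢ (𝟙 ∘ isFaceOfSize 0 Δ) ⊥ ⟩
    ∑ˢ (𝟙 ∘ isFaceOfSize 0 Δ)     ≡⟨ cl≡∑ˢ 0 Δ ⟨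
    cl 0 Δ                        ∎

weak-colorable-bound : ∀ k → WeakColorableBound k
weak-colorable-bound zero Δ _ = begin
  cl 1 Δ ^ 1          ≡⟨ ^-identityʳ (cl 1 Δ) ⟩
  cl 1 Δ              ≤⟨ cl≤cl₀*cl 1 Δ ⟩
  cl 0 Δ * cl 1 Δ     ≡⟨ cong (_* cl 1 Δ) (^-identityʳ (cl 0 Δ)) ⟨
  cl 0 Δ ^ 1 * cl 1 Δ ∎
  where open ≤-Reasoning
weak-colorable-bound (suc k) Δ col = begin
  F * F ^ suc k       ≤⟨ *-monoʳ-≤ F (colorable-step k (weak-colorable-bound k) Δ col) ⟩
  F * G ^ suc (suc k) ≡⟨ *-comm F _ ⟩
  G ^ suc (suc k) * F ∎
  where
  open ≤-Reasoning
  F = cl (suc (suc k)) Δ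
  G = cl (suc k) Δ

colorable-bound : ∀ k {n} (Δ : SimplicialComplex n) → Colorable (suc (suc k)) Δ →
  cl (suc (suc k)) Δ ^ suc k ≤ cl (suc k) Δ ^ suc (suc k)
colorable-bound k = colorable-step k (weak-colorable-bound k)

lemma2 : ∀ (t : ℕ) → 3 ≤ t → ∀ (n : ℕ) (Δ : SimplicialComplex n) → Colorable t Δ →
    cl t Δ ^ (t ∸ 1) * t ^ t ≤ 2 ^ (t * (t ∸ 1)) * cl (t ∸ 1) Δ ^ t
lemma2 (suc zero)    (s≤s ())
lemma2 (suc (suc t)) _ n Δ col = begin
  cl (suc (suc t)) Δ ^ suc t * suc (suc t) ^ suc (suc t)
    ≤⟨ *-mono-≤ (colorable-bound t Δ col) (n^n≤2^[n*[n∸1]] (suc (suc t))) ⟩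
  cl (suc t) Δ ^ suc (suc t) * 2 ^ (suc (suc t) * suc t)
    ≡⟨ *-comm (cl (suc t) Δ ^ suc (suc t)) _ ⟩
  2 ^ (suc (suc t) * suc t) * cl (suc t) Δ ^ suc (suc t) ∎
  where open ≤-Reasoning
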